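{- Let $G=(V_1,V_2;E)$ be an edge-colored bipartite graph with $|V_1|=n_1$, $|V_2|=n_2$, and let $t\geq s\geq 2$ be integers. If $\sum_{v\in V(G)}d^c(v)>n_1n_2+\sigma_{s,t}\left(n_1n_2^{1-1/s}+n_2n_1^{1-1/s}\right)+s(n_1+n_2)$, where $\sigma_{s,t}=s\left(\frac{t-1}{(s-1)!}\right)^{1/s}$, then $G$ contains a properly colored $K_{s,t}$.
   Context: All graphs are finite and simple. An edge-colored graph is a graph with a color assigned to each edge (not necessarily proper). $d^c(v)$ is the number of distinct colors on edges incident to $v$. A subgraph is properly colored if any two adjacent edges of it receive different colors. -}

module Defs where

open import Data.Nat using (ℕ; _+_; _*_; _^_; _!; _<_; _≥_; _≤_; _∸_)
open import Data.Nat.Properties using (_≟_)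
open import Data.Fin using (Fin)
open import Data.Nat.ListAction using (sum)
open import Data.List using (List; length; map; allFin; mapMaybe; deduplicate)
open import Data.Maybe using (Maybe; just)
open import Data.Product using (Σ; _×_; ∃; ∃-syntax)
open import Data.Sum using (_⊎_)
open import Function.Definitions using (Injective)
open import Relation.Binary.PropositionalEquality using (_≡_)

-- An edge-colored bipartite graph G = (V₁, V₂; E) with V₁ = Fin n₁, V₂ = Fin n₂.
-- col u v = nothing  : no edge between u ∈ V₁ and v ∈ V₂
-- col u v = just c   : edge uv present with color c (colors are natural numbers)
ColoredBipartite : ℕ → ℕ → Set
ColoredBipartite n₁ n₂ = Fin n₁ → Fin n₂ → Maybe ℕ

transposeG : ∀ {n₁ n₂} → ColoredBipartite n₁ n₂ → ColoredBipartite n₂ n₁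
transposeG G v u = G u v

dc₁ : ∀ {n₁ n₂} → ColoredBipartite n₁ n₂ → Fin n₁ → ℕ
dc₁ {n₁} {n₂} G u = length (deduplicate _≟_ (mapMaybe (G u) (allFin n₂)))

dc₂ : ∀ {n₁ n₂} → ColoredBipartite n₁ n₂ → Fin n₂ → ℕ
dc₂ G v = dc₁ (transposeG G) v

colorDegreeSum : ∀ {n₁ n₂} → ColoredBipartite n₁ n₂ → ℕ
colorDegreeSum {n₁} {n₂} G =
  sum (map (dc₁ G) (allFin n₁)) + sum (map (dc₂ G) (allFin n₂))

PCK : ∀ {n₁ n₂} → ColoredBipartite n₁ n₂ → ℕ → ℕ → Set
PCK {n₁} {n₂} G a b =
  Σ (Fin a → Fin n₁) λ f → Σ (Fin b → Fin n₂) λ g → Σ (Fin a → Fin b → ℕ) λ c →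
    Injective _≡_ _≡_ f × Injective _≡_ _≡_ g
    × (∀ i j → G (f i) (g j) ≡ just (c i j))
    × (∀ i j j′ → c i j ≡ c i j′ → j ≡ j′)
    × (∀ i i′ j → c i j ≡ c i′ j → i ≡ i′)

-- G contains a properly colored K_{s,t} (the s-side may lie in V₁ or in V₂;
-- since K_{s,t} is connected its bipartition agrees with that of G).
HasPCK : ∀ {n₁ n₂} → ColoredBipartite n₁ n₂ → ℕ → ℕ → Set
HasPCK G s t = PCK G s t ⊎ PCK (transposeG G) s t

-- The real-number hypothesis
--   S > n₁n₂ + σ_{s,t}(n₁ n₂^{1-1/s} + n₂ n₁^{1-1/s}) + s(n₁+n₂),
--   σ_{s,t} = s((t-1)/(s-1)!)^{1/s},
-- encoded exactly in ℕ.  Writing a = ((t-1) n₂^{s-1}/(s-1)!)^{1/s} and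
-- b = ((t-1) n₁^{s-1}/(s-1)!)^{1/s}, the right-hand side is
-- n₁n₂ + s(n₁ a + n₂ b) + s(n₁+n₂).  By density of ℚ the strict inequality
-- holds iff there are nonnegative rationals P/D ≥ a, Q/D ≥ b (D ≥ 1) with
-- S > n₁n₂ + s(n₁ P/D + n₂ Q/D) + s(n₁+n₂); clearing denominators gives:
DegreeCondition : ℕ → ℕ → ℕ → ℕ → ℕ → Set
DegreeCondition n₁ n₂ s t S =
  ∃[ P ] ∃[ Q ] ∃[ D ] (1 ≤ D
    × (t ∸ 1) * n₂ ^ (s ∸ 1) * D ^ s ≤ (s ∸ 1) ! * P ^ s
    × (t ∸ 1) * n₁ ^ (s ∸ 1) * D ^ s ≤ (s ∸ 1) ! * Q ^ s
    × n₁ * n₂ * D + s * (n₁ * P + n₂ * Q) + s * (n₁ + n₂) * D < S * D)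

{-# OPTIONS --safe #-}
-- At every vertex keep, for each of its colours, one incident edge of that colour, and let H
-- consist of the edges kept at both ends. An edge is kept at most twice, so
-- Σ d^c ≤ n₁n₂ + e(H), and since the H-edges at any vertex have distinct colours, every K_{s,t}
-- in H is properly coloured. If H has no K_{s,t} with its s-side in V₁, counting ordered s-stars
-- centred in V₂ (Kővári–Sós–Turán) gives Σ_v (d_v)_s ≤ (t−1)(n₁)_s; the power-mean inequality
-- turns this into e(H) ≤ s n₂ + n₁((t−1)n₂^{s−1})^{1/s}, which contradicts the degree
-- condition because (s−1)! ≤ s^s. The falling factorial (n)_s is the library's n P′ s.
module Submission where

open import Data.Nat
open import Data.Nat.Combinatorics.Base using (_P′_)
open import Data.Nat.Combinatorics.Specification using (nP′k≡n[n∸1P′k∸1])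
import Data.Nat.ListAction as List
open import Data.Nat.Properties
open import Data.Nat.Tactic.RingSolver using (solve-∀)
open import Data.Bool using (Bool; true; false; T; not; _∧_)
open import Data.Bool.Properties using (T-∧)
open import Data.Empty using (⊥-elim)
open import Data.Fin using (Fin; zero; suc; punchIn)
open import Data.Fin.Properties using (¬∀⟶∃¬; punchIn-injective; punchInᵢ≢i)
open import Data.List using (List; _∷_; length; map; tabulate; allFin; catMaybes; mapMaybe; deduplicate)
open import Data.List.Properties using (map-tabulate; length-filter; filter-notAll)
open import Data.List.Membership.Propositional using (_∈_; _∉_)
open import Data.List.Membership.Propositional.Properties using (∈-allFin; ∈-deduplicate⁺)
open import Data.List.Membership.DecPropositional _≟_ using (_∈?_)
import Data.List.Relation.Unary.Any as Any
open import Data.List.Relation.Unary.Any.Properties using (mapMaybe⁺; map⁺)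
open import Data.Maybe using (Maybe; just; nothing; maybe′)
import Data.Maybe.Relation.Unary.Any as Maybe
open import Data.Product using (Σ; _×_; _,_; ∃-syntax; proj₁; proj₂)
open import Data.Sum using (inj₁; [_,_]′)
open import Data.Vec.Functional as Vector using ()
open import Function using (_∘_; id; Injective; Equivalence)
open import Relation.Binary.Definitions using (DecidableEquality)
open import Relation.Binary.PropositionalEquality
open import Relation.Nullary using (yes; no; does; ¬?)
open import Algebra.Properties.Semiring.Sum +-*-semiring
  using (sum; sum-syntax; ∑-distrib-+; ∑-comm; sum-remove; *-distribˡ-sum; *-distribʳ-sum; sum-cong-≗)

open import Defs

∑-const : ∀ n c → ∑[ i < n ] c ≡ n * c
∑-const zero    c = refl
∑-const (suc n) c = cong (c +_) (∑-const n c)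

∑-mono-≤ : ∀ {n} {f g : Fin n → ℕ} → (∀ i → f i ≤ g i) → sum f ≤ sum g
∑-mono-≤ {zero}  f≤g = z≤n
∑-mono-≤ {suc n} f≤g = +-mono-≤ (f≤g zero) (∑-mono-≤ (f≤g ∘ suc))

∑<∑⇒∃< : ∀ {n} (f g : Fin n → ℕ) → sum f < sum g → ∃[ i ] f i < g i
∑<∑⇒∃< {n} f g ∑f<∑g
  with i , gᵢ≰fᵢ ← ¬∀⟶∃¬ n (λ i → g i ≤ f i) (λ i → g i ≤? f i) (<⇒≱ ∑f<∑g ∘ ∑-mono-≤)
  = i , ≰⇒> gᵢ≰fᵢ

∑∑-distrib-+ : ∀ {m n} (f g : Fin m → Fin n → ℕ) →
  ∑[ i < m ] ∑[ j < n ] (f i j + g i j) ≡ ∑[ i < m ] ∑[ j < n ] f i j + ∑[ i < m ] ∑[ j < n ] g i j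
∑∑-distrib-+ f g =
  trans (sum-cong-≗ (λ i → ∑-distrib-+ (f i) (g i))) (∑-distrib-+ (λ i → sum (f i)) (λ i → sum (g i)))

∑*∑ : ∀ {m n} (x : Fin m → ℕ) (y : Fin n → ℕ) → sum x * sum y ≡ ∑[ i < m ] ∑[ j < n ] (x i * y j)
∑*∑ x y = trans (*-distribʳ-sum (sum y) x) (sum-cong-≗ (λ i → *-distribˡ-sum (x i) y))

sum-tabulate : ∀ {n} (f : Fin n → ℕ) → List.sum (tabulate f) ≡ sum f
sum-tabulate {zero}  f = refl
sum-tabulate {suc n} f = cong (f zero +_) (sum-tabulate (f ∘ suc))

sum-allFin : ∀ {n} (f : Fin n → ℕ) → List.sum (map f (allFin n)) ≡ sum f
sum-allFin f = trans (cong List.sum (map-tabulate id f)) (sum-tabulate f)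

indicator : Bool → ℕ
indicator true  = 1
indicator false = 0

count : ∀ {n} → (Fin n → Bool) → ℕ
count {n} p = ∑[ i < n ] indicator (p i)

indicator-+-∧ : ∀ x y → indicator x + indicator y ≤ 1 + indicator (x ∧ y)
indicator-+-∧ true  true  = ≤-refl
indicator-+-∧ true  false = ≤-refl
indicator-+-∧ false true  = ≤-refl
indicator-+-∧ false false = z≤n

indicator-∧ : ∀ x y → indicator (x ∧ y) ≡ indicator y * indicator x
indicator-∧ true  true  = refl
indicator-∧ true  false = refl
indicator-∧ false true  = refl
indicator-∧ false false = refl

indicator-*-pred : ∀ x c → indicator x * c ≡ indicator x * pred (indicator x + c)
indicator-*-pred true  c = refl
indicator-*-pred false c = refl

P′-suc : ∀ n k → n P′ suc k ≡ n * (pred n P′ k)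
P′-suc zero    k = cong (_* (0 P′ k)) (0∸n≡0 k)
P′-suc (suc n) k = nP′k≡n[n∸1P′k∸1] (suc n) (suc k)

indicator-*-P′ : ∀ x c k → indicator x * (c P′ suc k) ≡ (indicator x * c) P′ suc k
indicator-*-P′ true  c k = trans (*-identityˡ (c P′ suc k)) (cong (_P′ suc k) (sym (*-identityˡ c)))
indicator-*-P′ false c k = sym (P′-suc 0 k)

module _ {A : Set} (_≟ᴬ_ : DecidableEquality A) where

  length-deduplicate-∷ : ∀ x xs →
    length (deduplicate _≟ᴬ_ (x ∷ xs)) ≤ suc (length (deduplicate _≟ᴬ_ xs))
  length-deduplicate-∷ x xs = s≤s (length-filter (¬? ∘ (x ≟ᴬ_)) (deduplicate _≟ᴬ_ xs))

  length-deduplicate-∷-∈ : ∀ {x xs} → x ∈ xs →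
    length (deduplicate _≟ᴬ_ (x ∷ xs)) ≤ length (deduplicate _≟ᴬ_ xs)
  length-deduplicate-∷-∈ {x} x∈xs =
    filter-notAll (¬? ∘ (x ≟ᴬ_)) _ (Any.map (λ x≡y x≢y → x≢y x≡y) (∈-deduplicate⁺ _≟ᴬ_ x∈xs))

Row : ℕ → Set
Row n = Fin n → Maybe ℕ

colours : ∀ {n} → Row n → List ℕ
colours {n} h = mapMaybe h (allFin n)

distinctColours : ∀ {n} → Row n → ℕ
distinctColours h = length (deduplicate _≟_ (colours h))

colours-suc : ∀ {n} (h : Row (suc n)) → colours h ≡ maybe′ _∷_ id (h zero) (colours (h ∘ suc))
colours-suc h = cong (λ hs → maybe′ _∷_ id (h zero) (catMaybes hs))
                     (trans (map-tabulate suc h) (sym (map-tabulate id (h ∘ suc))))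

colour∈colours : ∀ {n} (h : Row n) {w c} → h w ≡ just c → c ∈ colours h
colour∈colours {n} h {w} hw≡c = mapMaybe⁺ h (allFin n) (map⁺ (Any.map at-w (∈-allFin w)))
  where
  at-w : ∀ {x} → w ≡ x → Maybe.Any (_ ≡_) (h x)
  at-w refl = subst (Maybe.Any (_ ≡_)) (sym hw≡c) (Maybe.just refl)

isNewColour : Maybe ℕ → List ℕ → Bool
isNewColour nothing  cs = false
isNewColour (just c) cs = not (does (c ∈? cs))

T-isNewColour : ∀ {m cs} → T (isNewColour m cs) → ∃[ c ] m ≡ just c × c ∉ cs
T-isNewColour {just c} {cs} new with c ∈? cs
... | no c∉cs = c , refl , c∉cs

-- v is selected iff its colour does not occur after v, so each colour of the row is selected once.
lastOfColour : ∀ {n} → Row n → Fin n → Bool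
lastOfColour h zero    = isNewColour (h zero) (colours (h ∘ suc))
lastOfColour h (suc v) = lastOfColour (h ∘ suc) v

distinctColours≤count-lastOfColour : ∀ {n} (h : Row n) → distinctColours h ≤ count (lastOfColour h)
distinctColours≤count-lastOfColour {zero}  h = z≤n
distinctColours≤count-lastOfColour {suc n} h rewrite colours-suc h with h zero
... | nothing = distinctColours≤count-lastOfColour (h ∘ suc)
... | just c with c ∈? colours (h ∘ suc)
...   | yes c∈cs = ≤-trans (length-deduplicate-∷-∈ _≟_ c∈cs)
                           (distinctColours≤count-lastOfColour (h ∘ suc))
...   | no  _    = ≤-trans (length-deduplicate-∷ _≟_ c (colours (h ∘ suc)))
                           (s≤s (distinctColours≤count-lastOfColour (h ∘ suc)))

lastOfColour⇒coloured : ∀ {n} (h : Row n) v → T (lastOfColour h v) → ∃[ c ] h v ≡ just c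
lastOfColour⇒coloured h zero    last with c , hv≡c , _ ← T-isNewColour last = c , hv≡c
lastOfColour⇒coloured h (suc v) last = lastOfColour⇒coloured (h ∘ suc) v last

lastOfColour-injective : ∀ {n} (h : Row n) {v w} →
  T (lastOfColour h v) → T (lastOfColour h w) → h v ≡ h w → v ≡ w
lastOfColour-injective h {zero}  {zero}  _ _ _ = refl
lastOfColour-injective h {zero}  {suc w} last _ h₀≡hw with c , h₀≡c , c∉ ← T-isNewColour last =
  ⊥-elim (c∉ (colour∈colours (h ∘ suc) (trans (sym h₀≡hw) h₀≡c)))
lastOfColour-injective h {suc v} {zero}  _ last hv≡h₀ with c , h₀≡c , c∉ ← T-isNewColour last =
  ⊥-elim (c∉ (colour∈colours (h ∘ suc) (trans hv≡h₀ h₀≡c)))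
lastOfColour-injective h {suc v} {suc w} lastᵥ lastw hv≡hw =
  cong suc (lastOfColour-injective (h ∘ suc) lastᵥ lastw hv≡hw)

module _ {n m : ℕ} where

  Biclique : (Fin n → Fin m → Bool) → ℕ → ℕ → Set
  Biclique H a b = Σ (Fin a → Fin n) λ f → Σ (Fin b → Fin m) λ g →
    Injective _≡_ _≡_ f × Injective _≡_ _≡_ g × (∀ i j → T (H (f i) (g j)))

  degree : (Fin n → Fin m → Bool) → Fin m → ℕ
  degree H v = count (λ u → H u v)

  stars : (Fin n → Fin m → Bool) → ℕ → ℕ
  stars H s = ∑[ v < m ] (degree H v P′ s)

module _ {n₁ n₂ : ℕ} (G : ColoredBipartite n₁ n₂) where

  representativeEdges : Fin n₁ → Fin n₂ → Bool
  representativeEdges u v = lastOfColour (G u) v ∧ lastOfColour (λ x → G x v) u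

  colorDegreeSum≤ : colorDegreeSum G ≤ n₁ * n₂ + ∑[ v < n₂ ] degree representativeEdges v
  colorDegreeSum≤ = begin
    colorDegreeSum G
      ≡⟨ cong₂ _+_ (sum-allFin (dc₁ G)) (sum-allFin (dc₂ G)) ⟩
    sum (dc₁ G) + sum (dc₂ G)
      ≤⟨ +-mono-≤ (∑-mono-≤ (λ u → distinctColours≤count-lastOfColour (G u)))
                  (∑-mono-≤ (λ v → distinctColours≤count-lastOfColour (λ u → G u v))) ⟩
    ∑[ u < n₁ ] ∑[ v < n₂ ] r₁ v u + ∑[ v < n₂ ] ∑[ u < n₁ ] r₂ v u
      ≡⟨ cong (_+ ∑[ v < n₂ ] ∑[ u < n₁ ] r₂ v u) (∑-comm (λ u v → r₁ v u)) ⟩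
    ∑[ v < n₂ ] ∑[ u < n₁ ] r₁ v u + ∑[ v < n₂ ] ∑[ u < n₁ ] r₂ v u
      ≡⟨ ∑∑-distrib-+ r₁ r₂ ⟨
    ∑[ v < n₂ ] ∑[ u < n₁ ] (r₁ v u + r₂ v u)
      ≤⟨ ∑-mono-≤ (λ v → ∑-mono-≤ (λ u →
           indicator-+-∧ (lastOfColour (G u) v) (lastOfColour (λ x → G x v) u))) ⟩
    ∑[ v < n₂ ] ∑[ u < n₁ ] (1 + indicator (representativeEdges u v))
      ≡⟨ ∑∑-distrib-+ (λ _ _ → 1) (λ v u → indicator (representativeEdges u v)) ⟩
    ∑[ v < n₂ ] ∑[ u < n₁ ] 1 + E
      ≡⟨ cong (_+ E) (trans (sum-cong-≗ {n₂} (λ _ → trans (∑-const n₁ 1) (*-identityʳ n₁)))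
                            (trans (∑-const n₂ n₁) (*-comm n₂ n₁))) ⟩
    n₁ * n₂ + E ∎
    where
    open ≤-Reasoning
    E = ∑[ v < n₂ ] degree representativeEdges v
    r₁ r₂ : Fin n₂ → Fin n₁ → ℕ
    r₁ v u = indicator (lastOfColour (G u) v)
    r₂ v u = indicator (lastOfColour (λ x → G x v) u)

  representativeBiclique⇒PCK : ∀ {s t} → Biclique representativeEdges s t → PCK G s t
  representativeBiclique⇒PCK {s} {t} (f , g , f-inj , g-inj , edge) =
    f , g , colour , f-inj , g-inj , coloured , rowProper , columnProper
    where
    lastInRow : ∀ i j → T (lastOfColour (G (f i)) (g j))
    lastInRow i j = proj₁ (Equivalence.to T-∧ (edge i j))
    lastInColumn : ∀ i j → T (lastOfColour (λ x → G x (g j)) (f i))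
    lastInColumn i j = proj₂ (Equivalence.to T-∧ (edge i j))
    colour : Fin s → Fin t → ℕ
    colour i j = proj₁ (lastOfColour⇒coloured (G (f i)) (g j) (lastInRow i j))
    coloured : ∀ i j → G (f i) (g j) ≡ just (colour i j)
    coloured i j = proj₂ (lastOfColour⇒coloured (G (f i)) (g j) (lastInRow i j))
    sameEdgeColour : ∀ {i j i′ j′} → colour i j ≡ colour i′ j′ → G (f i) (g j) ≡ G (f i′) (g j′)
    sameEdgeColour {i} {j} {i′} {j′} c≡c′ =
      trans (coloured i j) (trans (cong just c≡c′) (sym (coloured i′ j′)))
    rowProper : ∀ i j j′ → colour i j ≡ colour i j′ → j ≡ j′
    rowProper i j j′ c≡c′ =
      g-inj (lastOfColour-injective (G (f i)) (lastInRow i j) (lastInRow i j′) (sameEdgeColour c≡c′))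
    columnProper : ∀ i i′ j → colour i j ≡ colour i′ j → i ≡ i′
    columnProper i i′ j c≡c′ =
      f-inj (lastOfColour-injective (λ x → G x (g j)) (lastInColumn i j) (lastInColumn i′ j)
                                    (sameEdgeColour c≡c′))

∷-punchIn-injective : ∀ {k n} (u : Fin (suc n)) {f : Fin k → Fin n} →
  Injective _≡_ _≡_ f → Injective _≡_ _≡_ (u Vector.∷ punchIn u ∘ f)
∷-punchIn-injective u         f-inj {zero}  {zero}  _  = refl
∷-punchIn-injective u {f = f} f-inj {zero}  {suc j} u≡ = ⊥-elim (punchInᵢ≢i u (f j) (sym u≡))
∷-punchIn-injective u {f = f} f-inj {suc i} {zero}  ≡u = ⊥-elim (punchInᵢ≢i u (f i) ≡u)
∷-punchIn-injective u {f = f} f-inj {suc i} {suc j} eq =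
  cong suc (f-inj (punchIn-injective u (f i) (f j) eq))

choose-distinct : ∀ {m} t (p : Fin m → Bool) → t ≤ count p →
  Σ (Fin t → Fin m) λ g → Injective _≡_ _≡_ g × (∀ j → T (p (g j)))
choose-distinct zero p _ = (λ ()) , (λ { {()} }) , (λ ())
choose-distinct {suc m} (suc t) p t<count with p zero in p₀≡
... | false with g , g-inj , pg ← choose-distinct (suc t) (p ∘ suc) t<count =
  suc ∘ g , (λ eq → g-inj (punchIn-injective zero _ _ eq)) , pg
... | true  with g , g-inj , pg ← choose-distinct t (p ∘ suc) (s≤s⁻¹ t<count) =
  zero Vector.∷ suc ∘ g , ∷-punchIn-injective zero g-inj ,
  λ { zero → subst T (sym p₀≡) _ ; (suc j) → pg j }

module _ {n m : ℕ} (H : Fin n → Fin m → Bool) (k t : ℕ) where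

  ∃-rich-vertex : (t ∸ 1) * (n P′ suc k) < stars H (suc k) →
    ∃[ u ] (t ∸ 1) * (pred n P′ k) < ∑[ v < m ] (indicator (H u v) * (pred (degree H v) P′ k))
  ∃-rich-vertex many = ∑<∑⇒∃< _ _ (subst₂ _<_ countVertices countStars many)
    where
    open ≡-Reasoning
    countVertices : (t ∸ 1) * (n P′ suc k) ≡ ∑[ u < n ] ((t ∸ 1) * (pred n P′ k))
    countVertices = begin
      (t ∸ 1) * (n P′ suc k)                ≡⟨ cong ((t ∸ 1) *_) (P′-suc n k) ⟩
      (t ∸ 1) * (n * (pred n P′ k))         ≡⟨ x*[y*z]≡y*[x*z] (t ∸ 1) n (pred n P′ k) ⟩
      n * ((t ∸ 1) * (pred n P′ k))         ≡⟨ ∑-const n _ ⟨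
      ∑[ u < n ] ((t ∸ 1) * (pred n P′ k))  ∎
      where
      x*[y*z]≡y*[x*z] : ∀ x y z → x * (y * z) ≡ y * (x * z)
      x*[y*z]≡y*[x*z] = solve-∀
    countStars : stars H (suc k) ≡ ∑[ u < n ] ∑[ v < m ] (indicator (H u v) * (pred (degree H v) P′ k))
    countStars = begin
      ∑[ v < m ] (degree H v P′ suc k)
        ≡⟨ sum-cong-≗ (λ v → P′-suc (degree H v) k) ⟩
      ∑[ v < m ] (degree H v * (pred (degree H v) P′ k))
        ≡⟨ sum-cong-≗ {m} (λ v → *-distribʳ-sum (pred (degree H v) P′ k) (λ u → indicator (H u v))) ⟩
      ∑[ v < m ] ∑[ u < n ] (indicator (H u v) * (pred (degree H v) P′ k))
        ≡⟨ ∑-comm (λ u v → indicator (H u v) * (pred (degree H v) P′ k)) ⟨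
      ∑[ u < n ] ∑[ v < m ] (indicator (H u v) * (pred (degree H v) P′ k)) ∎

module _ {n m : ℕ} (H : Fin (suc n) → Fin m → Bool) (u : Fin (suc n)) where

  -- A biclique here with a nonempty left side has its right side inside the neighbourhood of u.
  neighbourhoodGraph : Fin n → Fin m → Bool
  neighbourhoodGraph x v = H (punchIn u x) v ∧ H u v

  degree-neighbourhoodGraph : ∀ v → degree neighbourhoodGraph v ≡ indicator (H u v) * pred (degree H v)
  degree-neighbourhoodGraph v = begin
    ∑[ x < n ] indicator (H (punchIn u x) v ∧ H u v)
      ≡⟨ sum-cong-≗ {n} (λ x → indicator-∧ (H (punchIn u x) v) (H u v)) ⟩
    ∑[ x < n ] (indicator (H u v) * indicator (H (punchIn u x) v))
      ≡⟨ *-distribˡ-sum (indicator (H u v)) (λ x → indicator (H (punchIn u x) v)) ⟨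
    indicator (H u v) * ∑[ x < n ] indicator (H (punchIn u x) v)
      ≡⟨ indicator-*-pred (H u v) _ ⟩
    indicator (H u v) * pred (indicator (H u v) + ∑[ x < n ] indicator (H (punchIn u x) v))
      ≡⟨ cong (λ d → indicator (H u v) * pred d) (sum-remove {i = u} (λ x → indicator (H x v))) ⟨
    indicator (H u v) * pred (degree H v) ∎
    where open ≡-Reasoning

  stars-neighbourhoodGraph : ∀ k →
    ∑[ v < m ] (indicator (H u v) * (pred (degree H v) P′ suc k)) ≡ stars neighbourhoodGraph (suc k)
  stars-neighbourhoodGraph k = sum-cong-≗ {m} λ v →
    trans (indicator-*-P′ (H u v) (pred (degree H v)) k)
          (cong (_P′ suc k) (sym (degree-neighbourhoodGraph v)))

  Biclique-∷ : ∀ {k t} → Biclique neighbourhoodGraph (suc k) t → Biclique H (suc (suc k)) t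
  Biclique-∷ (f , g , f-inj , g-inj , edge) =
    u Vector.∷ punchIn u ∘ f , g , ∷-punchIn-injective u f-inj , g-inj , edge′
    where
    edge′ : ∀ i j → T (H ((u Vector.∷ punchIn u ∘ f) i) (g j))
    edge′ zero    j = proj₂ (Equivalence.to T-∧ (edge zero j))
    edge′ (suc i) j = proj₁ (Equivalence.to T-∧ (edge i j))

kővári-sós-turán : ∀ k t {n m} (H : Fin n → Fin m → Bool) →
  (t ∸ 1) * (n P′ suc k) < stars H (suc k) → Biclique H (suc k) t
kővári-sós-turán k t {zero} H many with ∃-rich-vertex H k t many
... | () , _
kővári-sós-turán zero t {suc n} {m} H many with u , rich ← ∃-rich-vertex H zero t many =
  let g , g-inj , edge = choose-distinct t (H u) (≤-trans (m≤n+m∸n t 1) t∸1<degree)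
  in (λ _ → u) , g , (λ { {zero} {zero} _ → refl }) , g-inj , (λ _ → edge)
  where
  t∸1<degree : t ∸ 1 < count (H u)
  t∸1<degree =
    subst₂ _<_ (*-identityʳ (t ∸ 1)) (sum-cong-≗ {m} (λ v → *-identityʳ (indicator (H u v)))) rich
kővári-sós-turán (suc k) t {suc n} H many with u , rich ← ∃-rich-vertex H (suc k) t many =
  Biclique-∷ H u (kővári-sós-turán k t (neighbourhoodGraph H u)
                                     (subst (_ <_) (stars-neighbourhoodGraph H u k) rich))

[n∸k]^k≤nP′k : ∀ n k → (n ∸ k) ^ k ≤ n P′ k
[n∸k]^k≤nP′k n zero    = ≤-refl
[n∸k]^k≤nP′k n (suc k) = *-mono-≤ n∸1+k≤n∸k (≤-trans (^-monoˡ-≤ k n∸1+k≤n∸k) ([n∸k]^k≤nP′k n k))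
  where
  n∸1+k≤n∸k : n ∸ suc k ≤ n ∸ k
  n∸1+k≤n∸k = ∸-monoʳ-≤ n (n≤1+n k)

nP′k≤n^k : ∀ n k → n P′ k ≤ n ^ k
nP′k≤n^k n zero    = ≤-refl
nP′k≤n^k n (suc k) = *-mono-≤ (m∸n≤m n k) (nP′k≤n^k n k)

n!≤n^n : ∀ n → n ! ≤ n ^ n
n!≤n^n zero    = ≤-refl
n!≤n^n (suc n) = *-monoʳ-≤ (suc n) (≤-trans (n!≤n^n n) (^-monoˡ-≤ n (n≤1+n n)))

[m*n]^k≡m^k*n^k : ∀ m n k → (m * n) ^ k ≡ m ^ k * n ^ k
[m*n]^k≡m^k*n^k m n zero    = refl
[m*n]^k≡m^k*n^k m n (suc k) =
  trans (cong (m * n *_) ([m*n]^k≡m^k*n^k m n k)) (interchange m n (m ^ k) (n ^ k))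
  where
  interchange : ∀ a b c d → a * b * (c * d) ≡ a * c * (b * d)
  interchange = solve-∀

^-cancelʳ-≤ : ∀ k {x y} → x ^ suc k ≤ y ^ suc k → x ≤ y
^-cancelʳ-≤ k xᵏ≤yᵏ = ≮⇒≥ (λ y<x → <⇒≱ (^-monoˡ-< (suc k) y<x) xᵏ≤yᵏ)

m+m≤n+n⇒m≤n : ∀ {m n} → m + m ≤ n + n → m ≤ n
m+m≤n+n⇒m≤n m+m≤n+n = ≮⇒≥ (λ n<m → <⇒≱ (+-mono-< n<m n<m) m+m≤n+n)

-- (b − a)(bᵏ − aᵏ) ≥ 0, written without subtraction.
rearrangement : ∀ a b k → a * b ^ k + b * a ^ k ≤ a ^ suc k + b ^ suc k
rearrangement a b k =
  [ ordered , (λ b≤a → subst₂ _≤_ (+-comm (b * a ^ k) _) (+-comm (b ^ suc k) _) (ordered b≤a)) ]′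
  (≤-total a b)
  where
  ordered : ∀ {a b} → a ≤ b → a * b ^ k + b * a ^ k ≤ a ^ suc k + b ^ suc k
  ordered {a} a≤b with c , refl ← m≤n⇒∃[o]m+o≡n a≤b | C , aᵏ+C≡bᵏ ← m≤n⇒∃[o]m+o≡n (^-monoˡ-≤ k a≤b)
    rewrite sym aᵏ+C≡bᵏ = ≤-trans (m≤m+n _ (c * C)) (≤-reflexive (expand a c (a ^ k) C))
    where
    expand : ∀ a c A C → a * (A + C) + (a + c) * A + c * C ≡ a * A + (a + c) * (A + C)
    expand = solve-∀

chebyshev : ∀ {m} (x : Fin m → ℕ) k → sum x * ∑[ i < m ] (x i ^ k) ≤ m * ∑[ i < m ] (x i ^ suc k)
chebyshev {m} x k = subst₂ _≤_ (sym (∑*∑ x (λ j → x j ^ k))) powers (m+m≤n+n⇒m≤n (begin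
    mixed + mixed
      ≡⟨ cong (mixed +_) (∑-comm {m} {m} (λ i j → x i * x j ^ k)) ⟩
    mixed + ∑[ i < m ] ∑[ j < m ] (x j * x i ^ k)
      ≡⟨ ∑∑-distrib-+ (λ i j → x i * x j ^ k) (λ i j → x j * x i ^ k) ⟨
    ∑[ i < m ] ∑[ j < m ] (x i * x j ^ k + x j * x i ^ k)
      ≤⟨ ∑-mono-≤ (λ i → ∑-mono-≤ (λ j → rearrangement (x i) (x j) k)) ⟩
    ∑[ i < m ] ∑[ j < m ] (x i ^ suc k + x j ^ suc k)
      ≡⟨ ∑∑-distrib-+ (λ i j → x i ^ suc k) (λ i j → x j ^ suc k) ⟩
    pure + ∑[ i < m ] ∑[ j < m ] (x j ^ suc k)
      ≡⟨ cong (pure +_) (∑-comm {m} {m} (λ i j → x i ^ suc k)) ⟨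
    pure + pure ∎))
  where
  open ≤-Reasoning
  mixed pure : ℕ
  mixed = ∑[ i < m ] ∑[ j < m ] (x i * x j ^ k)
  pure  = ∑[ i < m ] ∑[ j < m ] (x i ^ suc k)
  powers : pure ≡ m * ∑[ i < m ] (x i ^ suc k)
  powers = trans (sum-cong-≗ {m} (λ i → ∑-const m (x i ^ suc k)))
                 (sym (*-distribˡ-sum m (λ i → x i ^ suc k)))

power-mean : ∀ {m} (x : Fin m → ℕ) k → sum x ^ suc k ≤ m ^ k * ∑[ i < m ] (x i ^ suc k)
power-mean {m} x zero    = ≤-reflexive (begin-equality
  sum x * 1                    ≡⟨ *-identityʳ (sum x) ⟩
  sum x                        ≡⟨ sum-cong-≗ {m} (λ i → *-identityʳ (x i)) ⟨
  ∑[ i < m ] (x i ^ 1)         ≡⟨ *-identityˡ _ ⟨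
  1 * ∑[ i < m ] (x i ^ 1)     ∎)
  where open ≤-Reasoning
power-mean {m} x (suc k) = begin
  sum x * sum x ^ suc k                           ≤⟨ *-monoʳ-≤ (sum x) (power-mean x k) ⟩
  sum x * (m ^ k * ∑[ i < m ] (x i ^ suc k))      ≡⟨ x*[y*z]≡y*[x*z] (sum x) (m ^ k) _ ⟩
  m ^ k * (sum x * ∑[ i < m ] (x i ^ suc k))      ≤⟨ *-monoʳ-≤ (m ^ k) (chebyshev x (suc k)) ⟩
  m ^ k * (m * ∑[ i < m ] (x i ^ suc (suc k)))    ≡⟨ x*[y*z]≡y*[x*z] (m ^ k) m _ ⟩
  m * (m ^ k * ∑[ i < m ] (x i ^ suc (suc k)))    ≡⟨ *-assoc m (m ^ k) _ ⟨
  m * m ^ k * ∑[ i < m ] (x i ^ suc (suc k))      ∎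
  where
  open ≤-Reasoning
  x*[y*z]≡y*[x*z] : ∀ x y z → x * (y * z) ≡ y * (x * z)
  x*[y*z]≡y*[x*z] = solve-∀

few-stars⇒few-edges : ∀ {m} n k t P D (d : Fin m → ℕ) →
  ∑[ v < m ] (d v P′ suc k) ≤ (t ∸ 1) * n ^ suc k →
  (t ∸ 1) * m ^ k * D ^ suc k ≤ k ! * P ^ suc k →
  sum d * D ≤ suc k * m * D + suc k * n * P
few-stars⇒few-edges {m} n k t P D d fewStars hP = begin
  sum d * D                ≤⟨ *-monoˡ-≤ D sum≤ ⟩
  (m * s + X) * D          ≡⟨ *-distribʳ-+ D (m * s) X ⟩
  m * s * D + X * D        ≡⟨ cong (λ y → y * D + X * D) (*-comm m s) ⟩
  s * m * D + X * D        ≤⟨ +-monoʳ-≤ (s * m * D) (^-cancelʳ-≤ k [XD]^s≤[snP]^s) ⟩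
  s * m * D + s * n * P    ∎
  where
  open ≤-Reasoning
  s = suc k
  X = ∑[ v < m ] (d v ∸ s)
  sum≤ : sum d ≤ m * s + X
  sum≤ = ≤-trans (∑-mono-≤ (λ v → m≤n+m∸n (d v) s))
                 (≤-reflexive (trans (∑-distrib-+ (λ _ → s) (λ v → d v ∸ s)) (cong (_+ X) (∑-const m s))))
  X^s≤ : X ^ s ≤ m ^ k * ((t ∸ 1) * n ^ s)
  X^s≤ = ≤-trans (power-mean (λ v → d v ∸ s) k)
                 (*-monoʳ-≤ (m ^ k) (≤-trans (∑-mono-≤ (λ v → [n∸k]^k≤nP′k (d v) s)) fewStars))
  [XD]^s≤[snP]^s : (X * D) ^ s ≤ (s * n * P) ^ s
  [XD]^s≤[snP]^s = begin
    (X * D) ^ s                          ≡⟨ [m*n]^k≡m^k*n^k X D s ⟩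
    X ^ s * D ^ s                        ≤⟨ *-monoˡ-≤ (D ^ s) X^s≤ ⟩
    m ^ k * ((t ∸ 1) * n ^ s) * D ^ s    ≡⟨ regroup (m ^ k) (t ∸ 1) (n ^ s) (D ^ s) ⟩
    n ^ s * ((t ∸ 1) * m ^ k * D ^ s)    ≤⟨ *-monoʳ-≤ (n ^ s) hP ⟩
    n ^ s * (k ! * P ^ s)                ≤⟨ *-monoʳ-≤ (n ^ s) (*-monoˡ-≤ (P ^ s) k!≤s^s) ⟩
    n ^ s * (s ^ s * P ^ s)              ≡⟨ regroup′ (n ^ s) (s ^ s) (P ^ s) ⟩
    s ^ s * n ^ s * P ^ s                ≡⟨ cong (_* P ^ s) ([m*n]^k≡m^k*n^k s n s) ⟨
    (s * n) ^ s * P ^ s                  ≡⟨ [m*n]^k≡m^k*n^k (s * n) P s ⟨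
    (s * n * P) ^ s                      ∎
    where
    k!≤s^s : k ! ≤ s ^ s
    k!≤s^s = ≤-trans (n!≤n^n k) (≤-trans (^-monoˡ-≤ k (n≤1+n k)) (^-monoʳ-≤ s (n≤1+n k)))
    regroup : ∀ a b c e → a * (b * c) * e ≡ c * (b * a * e)
    regroup = solve-∀
    regroup′ : ∀ a b c → a * (b * c) ≡ b * a * c
    regroup′ = solve-∀

theorem4p3 : (n₁ n₂ s t : ℕ) → 2 ≤ s → s ≤ t → (G : ColoredBipartite n₁ n₂)
    → DegreeCondition n₁ n₂ s t (colorDegreeSum G)
    → HasPCK G s t
theorem4p3 n₁ n₂ (suc k) t (s≤s _) _ G (P , Q , D , _ , hP , _ , hS)
  with (t ∸ 1) * (n₁ P′ suc k) <? stars (representativeEdges G) (suc k)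
... | yes manyStars =
  inj₁ (representativeBiclique⇒PCK G (kővári-sós-turán k t (representativeEdges G) manyStars))
... | no ¬manyStars = ⊥-elim (<⇒≱ hS (begin
  colorDegreeSum G * D                       ≤⟨ *-monoˡ-≤ D (colorDegreeSum≤ G) ⟩
  (n₁ * n₂ + E) * D                          ≡⟨ *-distribʳ-+ D (n₁ * n₂) E ⟩
  n₁ * n₂ * D + E * D                        ≤⟨ +-monoʳ-≤ (n₁ * n₂ * D) fewEdges ⟩
  n₁ * n₂ * D + (s * n₂ * D + s * n₁ * P)    ≤⟨ m≤m+n _ (s * (n₂ * Q) + s * n₁ * D) ⟩
  n₁ * n₂ * D + (s * n₂ * D + s * n₁ * P) + (s * (n₂ * Q) + s * n₁ * D)
                                             ≡⟨ regroup n₁ n₂ s P Q D ⟩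
  n₁ * n₂ * D + s * (n₁ * P + n₂ * Q) + s * (n₁ + n₂) * D ∎))
  where
  open ≤-Reasoning
  s = suc k
  H = representativeEdges G
  E = ∑[ v < n₂ ] degree H v
  fewStars : stars H s ≤ (t ∸ 1) * n₁ ^ s
  fewStars = ≤-trans (≮⇒≥ ¬manyStars) (*-monoʳ-≤ (t ∸ 1) (nP′k≤n^k n₁ s))
  fewEdges : E * D ≤ s * n₂ * D + s * n₁ * P
  fewEdges = few-stars⇒few-edges n₁ k t P D (degree H) fewStars hP
  regroup : ∀ n₁ n₂ s P Q D → n₁ * n₂ * D + (s * n₂ * D + s * n₁ * P) + (s * (n₂ * Q) + s * n₁ * D)
                            ≡ n₁ * n₂ * D + s * (n₁ * P + n₂ * Q) + s * (n₁ + n₂) * D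
  regroup = solve-∀
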